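{- Let $t, s$ be $\lambda$-terms. (1) $t \simeq_\beta s$ iff $t^{n} \simeq_{\mathsf{v}} s^{n}$ iff $t^{n}\simeq_{\mathsf{b}} s^{n}$. (2) $t$ is $\beta$-normal iff $t^{n}$ is $\mathsf{v}$-normal iff $t^{n}$ is $\mathsf{b}$-normal; and $t$ is ground $\beta$-normal (i.e. $\to_{\mathsf{w}\beta}$-normal) iff $t^{n}$ is $\to_{\mathsf{wv}}$-normal iff $t^{n}$ is $\to_{\mathsf{wb}}$-normal.
   Context: $\lambda$-terms: $t ::= x \mid \lambda x\,t \mid t\,s$. $\lambda$-contexts $C ::= [\cdot]\mid \lambda x\,C \mid C\,t \mid t\,C$; CbN ground contexts $N ::= [\cdot] \mid \lambda x\,N \mid N\,t$. $(\lambda x\,t)\,s \mapsto_\beta t\{s/x\}$; $\to_\beta$ is its closure under $\lambda$-contexts and $\to_{\mathsf{w}\beta}$ its closure under CbN ground contexts. Bang calculus: terms $T,S ::= x \mid \lambda x\,T \mid T\,S \mid \mathrm{der}\,T \mid {!T}$; contexts $C ::= [\cdot] \mid \lambda x\,C \mid C\,T \mid T\,C \mid \mathrm{der}\,C \mid {!C}$; ground contexts $W ::= [\cdot] \mid \lambda x\,W \mid W\,T \mid T\,W \mid \mathrm{der}\,W$. Root steps $(\lambda x\,T)\,({!S}) \mapsto_{\mathsf{v}} T\{S/x\}$, $\mathrm{der}\,({!T})\mapsto_{\mathsf{d}} T$, $\mapsto_{\mathsf{b}} = \mapsto_{\mathsf{v}}\cup\mapsto_{\mathsf{d}}$; $\to_{\mathsf{r}}$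 is closure under contexts, $\to_{\mathsf{wr}}$ closure under ground contexts. For a relation $\to_{\mathsf{r}}$, $\simeq_{\mathsf{r}}$ is its reflexive, symmetric, transitive closure, and a term is $\mathsf{r}$-normal if it has no $\to_{\mathsf{r}}$-successor. CbN translation: $x^{n} = x$, $(\lambda x\,t)^{n} = \lambda x\,t^{n}$, $(t\,s)^{n} = t^{n}\,{!(s^{n})}$. -}

module Defs where

-- Terms are represented with de Bruijn indices (variables = natural numbers),
-- so that t{s/x} is capture-avoiding substitution of the bound variable 0.

open import Data.Nat using (ℕ; zero; suc)
open import Data.Product using (∃)
open import Relation.Nullary using (¬_)
open import Relation.Binary.Construct.Closure.Equivalence using (EqClosure)

data Λ : Set where
  var : ℕ → Λ
  lam : Λ → Λ
  app : Λ → Λ → Λ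

ext : (ℕ → ℕ) → ℕ → ℕ
ext ρ zero    = zero
ext ρ (suc n) = suc (ρ n)

renΛ : (ℕ → ℕ) → Λ → Λ
renΛ ρ (var x)   = var (ρ x)
renΛ ρ (lam t)   = lam (renΛ (ext ρ) t)
renΛ ρ (app t s) = app (renΛ ρ t) (renΛ ρ s)

extsΛ : (ℕ → Λ) → ℕ → Λ
extsΛ σ zero    = var zero
extsΛ σ (suc n) = renΛ suc (σ n)

subΛ : (ℕ → Λ) → Λ → Λ
subΛ σ (var x)   = σ x
subΛ σ (lam t)   = lam (subΛ (extsΛ σ) t)
subΛ σ (app t s) = app (subΛ σ t) (subΛ σ s)

single : {A : Set} → (ℕ → A) → A → ℕ → A
single v s zero    = s
single v s (suc n) = v n

_[_]Λ : Λ → Λ → Λ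
t [ s ]Λ = subΛ (single var s) t

data _↦β_ : Λ → Λ → Set where
  beta : ∀ {t s} → app (lam t) s ↦β (t [ s ]Λ)

data _→β_ : Λ → Λ → Set where
  root : ∀ {t u} → t ↦β u → t →β u
  ξlam : ∀ {t u} → t →β u → lam t →β lam u
  ξappL : ∀ {t u s} → t →β u → app t s →β app u s
  ξappR : ∀ {t s r} → s →β r → app t s →β app t r

data _→wβ_ : Λ → Λ → Set where
  root : ∀ {t u} → t ↦β u → t →wβ u
  ξlam : ∀ {t u} → t →wβ u → lam t →wβ lam u
  ξappL : ∀ {t u s} → t →wβ u → app t s →wβ app u s

data B : Set where
  var  : ℕ → B
  lam  : B → B
  app  : B → B → B
  der  : B → B
  bang : B → B

renB : (ℕ → ℕ) → B → B
renB ρ (var x)   = var (ρ x)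
renB ρ (lam t)   = lam (renB (ext ρ) t)
renB ρ (app t s) = app (renB ρ t) (renB ρ s)
renB ρ (der t)   = der (renB ρ t)
renB ρ (bang t)  = bang (renB ρ t)

extsB : (ℕ → B) → ℕ → B
extsB σ zero    = var zero
extsB σ (suc n) = renB suc (σ n)

subB : (ℕ → B) → B → B
subB σ (var x)   = σ x
subB σ (lam t)   = lam (subB (extsB σ) t)
subB σ (app t s) = app (subB σ t) (subB σ s)
subB σ (der t)   = der (subB σ t)
subB σ (bang t)  = bang (subB σ t)

_[_]B : B → B → B
t [ s ]B = subB (single var s) t

data _↦v_ : B → B → Set where
  betav : ∀ {t s} → app (lam t) (bang s) ↦v (t [ s ]B)

data _↦d_ : B → B → Set where
  derbang : ∀ {t} → der (bang t) ↦d t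

data _↦b_ : B → B → Set where
  v : ∀ {t u} → t ↦v u → t ↦b u
  d : ∀ {t u} → t ↦d u → t ↦b u

data Ctx (R : B → B → Set) : B → B → Set where
  root  : ∀ {t u} → R t u → Ctx R t u
  ξlam  : ∀ {t u} → Ctx R t u → Ctx R (lam t) (lam u)
  ξappL : ∀ {t u s} → Ctx R t u → Ctx R (app t s) (app u s)
  ξappR : ∀ {t s r} → Ctx R s r → Ctx R (app t s) (app t r)
  ξder  : ∀ {t u} → Ctx R t u → Ctx R (der t) (der u)
  ξbang : ∀ {t u} → Ctx R t u → Ctx R (bang t) (bang u)

data Ground (R : B → B → Set) : B → B → Set where
  root  : ∀ {t u} → R t u → Ground R t u
  ξlam  : ∀ {t u} → Ground R t u → Ground R (lam t) (lam u)
  ξappL : ∀ {t u s} → Ground R t u → Ground R (app t s) (app u s)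
  ξappR : ∀ {t s r} → Ground R s r → Ground R (app t s) (app t r)
  ξder  : ∀ {t u} → Ground R t u → Ground R (der t) (der u)

_→v_ _→b_ _→wv_ _→wb_ : B → B → Set
_→v_  = Ctx _↦v_
_→b_  = Ctx _↦b_
_→wv_ = Ground _↦v_
_→wb_ = Ground _↦b_

Equiv : {A : Set} → (A → A → Set) → A → A → Set
Equiv R = EqClosure R

Normal : {A : Set} → (A → A → Set) → A → Set
Normal R t = ¬ ∃ (λ u → R t u)

⟦_⟧n : Λ → B
⟦ var x ⟧n   = var x
⟦ lam t ⟧n   = lam ⟦ t ⟧n
⟦ app t s ⟧n = app ⟦ t ⟧n (bang ⟦ s ⟧n)

-- β-steps are simulated by v-steps of the translation, in any context and in ground
-- contexts alike. Conversely, erasing der and ! maps every b-step to a β-step or to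
-- an identity, and erasure is a left inverse of the translation, so b-conversion of
-- translations reflects β-conversion. For normal forms, a b-redex of a translation
-- can only be the image of a β-redex, because translated arguments sit under ! and
-- translations contain no der.
module Submission where

open import Defs
open import Data.Nat using (zero; suc)
open import Data.Product using (_×_; _,_; ∃; map)
open import Function.Base using (id)
open import Function.Bundles using (_⇔_; mk⇔)
open import Relation.Binary.PropositionalEquality using (_≡_; refl; cong; cong₂; trans; subst₂)
import Relation.Binary.Construct.Closure.Equivalence as EqClosure

⟦⟧-renΛ : ∀ ρ t → ⟦ renΛ ρ t ⟧n ≡ renB ρ ⟦ t ⟧n
⟦⟧-renΛ ρ (var x)   = refl
⟦⟧-renΛ ρ (lam t)   = cong lam (⟦⟧-renΛ (ext ρ) t)
⟦⟧-renΛ ρ (app t s) = cong₂ (λ a b → app a (bang b)) (⟦⟧-renΛ ρ t) (⟦⟧-renΛ ρ s)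

⟦⟧-subΛ : ∀ σ τ → (∀ x → ⟦ σ x ⟧n ≡ τ x) → ∀ t → ⟦ subΛ σ t ⟧n ≡ subB τ ⟦ t ⟧n
⟦⟧-subΛ σ τ σ≗τ (var x)   = σ≗τ x
⟦⟧-subΛ σ τ σ≗τ (lam t)   = cong lam (⟦⟧-subΛ (extsΛ σ) (extsB τ) exts≗ t)
  where
  exts≗ : ∀ x → ⟦ extsΛ σ x ⟧n ≡ extsB τ x
  exts≗ zero    = refl
  exts≗ (suc x) = trans (⟦⟧-renΛ suc (σ x)) (cong (renB suc) (σ≗τ x))
⟦⟧-subΛ σ τ σ≗τ (app t s) = cong₂ (λ a b → app a (bang b)) (⟦⟧-subΛ σ τ σ≗τ t) (⟦⟧-subΛ σ τ σ≗τ s)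

⟦⟧-[] : ∀ t s → ⟦ t [ s ]Λ ⟧n ≡ ⟦ t ⟧n [ ⟦ s ⟧n ]B
⟦⟧-[] t s = ⟦⟧-subΛ (single var s) (single var ⟦ s ⟧n) single≗ t
  where
  single≗ : ∀ x → ⟦ single var s x ⟧n ≡ single var ⟦ s ⟧n x
  single≗ zero    = refl
  single≗ (suc x) = refl

⟦⟧-↦β : ∀ {t u} → t ↦β u → ⟦ t ⟧n ↦v ⟦ u ⟧n
⟦⟧-↦β (beta {t} {s}) rewrite ⟦⟧-[] t s = betav

⟦⟧-→β : ∀ {t u} → t →β u → ⟦ t ⟧n →v ⟦ u ⟧n
⟦⟧-→β (root r)  = root (⟦⟧-↦β r)
⟦⟧-→β (ξlam r)  = ξlam (⟦⟧-→β r)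
⟦⟧-→β (ξappL r) = ξappL (⟦⟧-→β r)
⟦⟧-→β (ξappR r) = ξappR (ξbang (⟦⟧-→β r))

⟦⟧-→wβ : ∀ {t u} → t →wβ u → ⟦ t ⟧n →wv ⟦ u ⟧n
⟦⟧-→wβ (root r)  = root (⟦⟧-↦β r)
⟦⟧-→wβ (ξlam r)  = ξlam (⟦⟧-→wβ r)
⟦⟧-→wβ (ξappL r) = ξappL (⟦⟧-→wβ r)

Ctx-map : ∀ {R S : B → B → Set} → (∀ {T U} → R T U → S T U) → ∀ {T U} → Ctx R T U → Ctx S T U
Ctx-map R⇒S (root r)  = root (R⇒S r)
Ctx-map R⇒S (ξlam r)  = ξlam (Ctx-map R⇒S r)
Ctx-map R⇒S (ξappL r) = ξappL (Ctx-map R⇒S r)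
Ctx-map R⇒S (ξappR r) = ξappR (Ctx-map R⇒S r)
Ctx-map R⇒S (ξder r)  = ξder (Ctx-map R⇒S r)
Ctx-map R⇒S (ξbang r) = ξbang (Ctx-map R⇒S r)

Ground-map : ∀ {R S : B → B → Set} → (∀ {T U} → R T U → S T U) → ∀ {T U} → Ground R T U → Ground S T U
Ground-map R⇒S (root r)  = root (R⇒S r)
Ground-map R⇒S (ξlam r)  = ξlam (Ground-map R⇒S r)
Ground-map R⇒S (ξappL r) = ξappL (Ground-map R⇒S r)
Ground-map R⇒S (ξappR r) = ξappR (Ground-map R⇒S r)
Ground-map R⇒S (ξder r)  = ξder (Ground-map R⇒S r)

erase : B → Λ
erase (var x)   = var x
erase (lam t)   = lam (erase t)
erase (app t s) = app (erase t) (erase s)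
erase (der t)   = erase t
erase (bang t)  = erase t

erase-⟦⟧ : ∀ t → erase ⟦ t ⟧n ≡ t
erase-⟦⟧ (var x)   = refl
erase-⟦⟧ (lam t)   = cong lam (erase-⟦⟧ t)
erase-⟦⟧ (app t s) = cong₂ app (erase-⟦⟧ t) (erase-⟦⟧ s)

erase-renB : ∀ ρ T → erase (renB ρ T) ≡ renΛ ρ (erase T)
erase-renB ρ (var x)   = refl
erase-renB ρ (lam T)   = cong lam (erase-renB (ext ρ) T)
erase-renB ρ (app T S) = cong₂ app (erase-renB ρ T) (erase-renB ρ S)
erase-renB ρ (der T)   = erase-renB ρ T
erase-renB ρ (bang T)  = erase-renB ρ T

erase-subB : ∀ τ σ → (∀ x → erase (τ x) ≡ σ x) → ∀ T → erase (subB τ T) ≡ subΛ σ (erase T)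
erase-subB τ σ τ≗σ (var x)   = τ≗σ x
erase-subB τ σ τ≗σ (lam T)   = cong lam (erase-subB (extsB τ) (extsΛ σ) exts≗ T)
  where
  exts≗ : ∀ x → erase (extsB τ x) ≡ extsΛ σ x
  exts≗ zero    = refl
  exts≗ (suc x) = trans (erase-renB suc (τ x)) (cong (renΛ suc) (τ≗σ x))
erase-subB τ σ τ≗σ (app T S) = cong₂ app (erase-subB τ σ τ≗σ T) (erase-subB τ σ τ≗σ S)
erase-subB τ σ τ≗σ (der T)   = erase-subB τ σ τ≗σ T
erase-subB τ σ τ≗σ (bang T)  = erase-subB τ σ τ≗σ T

erase-[] : ∀ T S → erase (T [ S ]B) ≡ erase T [ erase S ]Λ
erase-[] T S = erase-subB (single var S) (single var (erase S)) single≗ T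
  where
  single≗ : ∀ x → erase (single var S x) ≡ single var (erase S) x
  single≗ zero    = refl
  single≗ (suc x) = refl

erase-→b : ∀ {T U} → T →b U → Equiv _→β_ (erase T) (erase U)
erase-→b (root (v (betav {T} {S}))) rewrite erase-[] T S = EqClosure.return (root beta)
erase-→b (root (d derbang)) = EqClosure.reflexive _→β_
erase-→b (ξlam r)  = EqClosure.gmap lam ξlam (erase-→b r)
erase-→b (ξappL r) = EqClosure.gmap (λ t → app t _) ξappL (erase-→b r)
erase-→b (ξappR r) = EqClosure.gmap (app _) ξappR (erase-→b r)
erase-→b (ξder r)  = erase-→b r
erase-→b (ξbang r) = erase-→b r

⟦⟧-Equiv-→b-reflects : ∀ {t s} → Equiv _→b_ ⟦ t ⟧n ⟦ s ⟧n → Equiv _→β_ t s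
⟦⟧-Equiv-→b-reflects {t} {s} e =
  subst₂ (Equiv _→β_) (erase-⟦⟧ t) (erase-⟦⟧ s)
    (EqClosure.gfold (EqClosure.isEquivalence _→β_) erase erase-→b e)

⟦⟧-↦b-reflects : ∀ t {U} → ⟦ t ⟧n ↦b U → ∃ (t ↦β_)
⟦⟧-↦b-reflects (app (lam t) s)    (v betav) = _ , beta
⟦⟧-↦b-reflects (var x)            (v ())
⟦⟧-↦b-reflects (var x)            (d ())
⟦⟧-↦b-reflects (lam t)            (v ())
⟦⟧-↦b-reflects (lam t)            (d ())
⟦⟧-↦b-reflects (app (var x) s)    (v ())
⟦⟧-↦b-reflects (app (app t t′) s) (v ())
⟦⟧-↦b-reflects (app t s)          (d ())

⟦⟧-→b-reflects : ∀ t {U} → ⟦ t ⟧n →b U → ∃ (t →β_)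
⟦⟧-→b-reflects (lam t)   (ξlam r)                = map lam ξlam (⟦⟧-→b-reflects t r)
⟦⟧-→b-reflects (app t s) (ξappL r)               = map (λ u → app u s) ξappL (⟦⟧-→b-reflects t r)
⟦⟧-→b-reflects t         (root r)                = map _ root (⟦⟧-↦b-reflects t r)
⟦⟧-→b-reflects (app t s) (ξappR (root (v ())))
⟦⟧-→b-reflects (app t s) (ξappR (root (d ())))
⟦⟧-→b-reflects (app t s) (ξappR (ξbang r))       = map (app t) ξappR (⟦⟧-→b-reflects s r)

⟦⟧-→wb-reflects : ∀ t {U} → ⟦ t ⟧n →wb U → ∃ (t →wβ_)
⟦⟧-→wb-reflects (lam t)   (ξlam r)              = map lam ξlam (⟦⟧-→wb-reflects t r)
⟦⟧-→wb-reflects (app t s) (ξappL r)             = map (λ u → app u s) ξappL (⟦⟧-→wb-reflects t r)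
⟦⟧-→wb-reflects t         (root r)              = map _ root (⟦⟧-↦b-reflects t r)
⟦⟧-→wb-reflects (app t s) (ξappR (root (v ())))
⟦⟧-→wb-reflects (app t s) (ξappR (root (d ())))

Normal-reflects : ∀ {A C : Set} (R : A → A → Set) (S : C → C → Set) (f : A → C) {a} →
                  (∀ {b} → R a b → S (f a) (f b)) → Normal S (f a) → Normal R a
Normal-reflects _ _ f simulate S-normal (b , r) = S-normal (f b , simulate r)

Normal-preserves : ∀ {A C : Set} (R : A → A → Set) (S : C → C → Set) (f : A → C) {a} →
                   (∀ {U} → S (f a) U → ∃ (R a)) → Normal R a → Normal S (f a)
Normal-preserves _ _ _ reflect R-normal (U , r) = R-normal (reflect r)

⇔-cycle : ∀ {P Q R : Set} → (P → Q) → (Q → R) → (R → P) → (P ⇔ Q) × (Q ⇔ R)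
⇔-cycle p→q q→r r→p = mk⇔ p→q (λ q → r→p (q→r q)) , mk⇔ q→r (λ r → p→q (r→p r))

⇔-cycle⁻¹ : ∀ {P Q R : Set} → (P → R) → (R → Q) → (Q → P) → (P ⇔ Q) × (Q ⇔ R)
⇔-cycle⁻¹ p→r r→q q→p = mk⇔ (λ p → r→q (p→r p)) q→p , mk⇔ (λ q → p→r (q→p q)) r→q

corollary10 : (t s : Λ) →
    ((Equiv _→β_ t s ⇔ Equiv _→v_ ⟦ t ⟧n ⟦ s ⟧n) × (Equiv _→v_ ⟦ t ⟧n ⟦ s ⟧n ⇔ Equiv _→b_ ⟦ t ⟧n ⟦ s ⟧n))
    × ((Normal _→β_ t ⇔ Normal _→v_ ⟦ t ⟧n) × (Normal _→v_ ⟦ t ⟧n ⇔ Normal _→b_ ⟦ t ⟧n))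
    × ((Normal _→wβ_ t ⇔ Normal _→wv_ ⟦ t ⟧n) × (Normal _→wv_ ⟦ t ⟧n ⇔ Normal _→wb_ ⟦ t ⟧n))
corollary10 t s =
    ⇔-cycle (EqClosure.gmap ⟦_⟧n ⟦⟧-→β) (EqClosure.map (Ctx-map v)) ⟦⟧-Equiv-→b-reflects
  , ⇔-cycle⁻¹ (Normal-preserves _→β_ _→b_ ⟦_⟧n (⟦⟧-→b-reflects t))
              (Normal-reflects _→v_ _→b_ id (Ctx-map v))
              (Normal-reflects _→β_ _→v_ ⟦_⟧n ⟦⟧-→β)
  , ⇔-cycle⁻¹ (Normal-preserves _→wβ_ _→wb_ ⟦_⟧n (⟦⟧-→wb-reflects t))
              (Normal-reflects _→wv_ _→wb_ id (Ground-map v))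
              (Normal-reflects _→wβ_ _→wv_ ⟦_⟧n ⟦⟧-→wβ)
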